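{- Let $n$ be a positive integer and let $D_n$ be a maximal Diophantine graph of order $n$. Then the clique number of $D_n$ is $$Cl(D_n)=\tau(n)+\pi(n)-\omega(n)+\gamma_1(n).$$ In particular, if $n$ is prime, then $Cl(D_n)=\pi(n)+1$.
   Context: All graphs are finite, simple and undirected. A graph $G$ with $n$ vertices is Diophantine if there is a bijection $f:V(G)\to\{1,\dots,n\}$ such that $\gcd(f(u),f(v))\mid n$ for every edge $uv$. A maximal Diophantine graph $D_n$ of order $n$ is a Diophantine graph of order $n$ such that adding any new edge yields a non-Diophantine graph. $Cl(G)$ denotes the clique number (order of a largest complete subgraph) of $G$. $\pi(n)$ is the number of primes $\le n$, $\omega(n)$ the number of distinct prime divisors of $n$, $\tau(n)$ the number of positive divisors of $n$. For a prime $p$, $\acute{v}_p(n):=v_p(n)+1$ where $v_p$ is the $p$-adic valuation, and $\gamma_1(n):=\left|\{p^{\acute{v}_p(n)}: p\text{ prime},\ p\mid n,\ 1<p^{\acute{v}_p(n)}<n\}\right|$. -}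

module Defs where

open import Data.Nat using (ℕ; zero; suc; _+_; _∸_; _^_; _<_; _<ᵇ_)
open import Data.Nat.Divisibility using (_∣_; _∣?_)
open import Data.Nat.GCD using (gcd)
open import Data.Nat.Primality using (Prime; prime?)
open import Data.Bool using (Bool; true; false; if_then_else_; _∧_; _∨_)
open import Data.Fin using (Fin; toℕ)
open import Data.Fin.Subset using (Subset; _∈_; ∣_∣)
open import Data.Fin.Permutation using (Permutation′; _⟨$⟩ʳ_)
open import Data.Product using (Σ; _×_)
open import Data.Sum using (_⊎_)
open import Relation.Nullary using (¬_)
open import Relation.Nullary.Decidable using (⌊_⌋)
open import Relation.Binary.PropositionalEquality using (_≡_; _≢_)

record Graph (n : ℕ) : Set where
  field
    adj    : Fin n → Fin n → Bool
    sym    : ∀ u v → adj u v ≡ adj v u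
    irrefl : ∀ u → adj u u ≡ false
open Graph public

label : {n : ℕ} → Permutation′ n → Fin n → ℕ
label f u = suc (toℕ (f ⟨$⟩ʳ u))

DiophantineRel : (n : ℕ) → (Fin n → Fin n → Set) → Set
DiophantineRel n E =
  Σ (Permutation′ n) λ f → ∀ u v → E u v → gcd (label f u) (label f v) ∣ n

Diophantine : {n : ℕ} → Graph n → Set
Diophantine {n} G = DiophantineRel n (λ u v → adj G u v ≡ true)

addEdgeRel : {n : ℕ} → Graph n → Fin n → Fin n → Fin n → Fin n → Set
addEdgeRel G u v x y =
  (adj G x y ≡ true) ⊎ ((x ≡ u × y ≡ v) ⊎ (x ≡ v × y ≡ u))

MaximalDiophantine : {n : ℕ} → Graph n → Set
MaximalDiophantine {n} G =
  Diophantine G ×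
  (∀ u v → u ≢ v → adj G u v ≡ false → ¬ DiophantineRel n (addEdgeRel G u v))

IsClique : {n : ℕ} → Graph n → Subset n → Set
IsClique G S = ∀ u v → u ∈ S → v ∈ S → u ≢ v → adj G u v ≡ true

IsCliqueNumber : {n : ℕ} → Graph n → ℕ → Set
IsCliqueNumber G k =
  (Σ (Subset _) λ S → IsClique G S × ∣ S ∣ ≡ k) ×
  (∀ S → IsClique G S → ∣ S ∣ Data.Nat.≤ k)

count : (ℕ → Bool) → ℕ → ℕ
count P zero    = zero
count P (suc n) = (if P (suc n) then 1 else 0) + count P n

anyUpTo : (ℕ → Bool) → ℕ → Bool
anyUpTo P zero    = false
anyUpTo P (suc n) = P (suc n) ∨ anyUpTo P n

isPrime : ℕ → Bool
isPrime p = ⌊ prime? p ⌋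

divides : ℕ → ℕ → Bool
divides d n = ⌊ d ∣? n ⌋

τ : ℕ → ℕ
τ n = count (λ d → divides d n) n

π : ℕ → ℕ
π n = count isPrime n

ω : ℕ → ℕ
ω n = count (λ p → isPrime p ∧ divides p n) n

-- v_p(n): the largest k (k ≤ n) with p^k ∣ n  (the p-adic valuation for n ≥ 1, p ≥ 2)
vp : ℕ → ℕ → ℕ
vp p n = go n
  where
  go : ℕ → ℕ
  go zero    = zero
  go (suc k) = if divides (p ^ suc k) n then suc k else go k

vp′ : ℕ → ℕ → ℕ
vp′ p n = vp p n + 1

-- γ₁(n) = |{ p^{v́_p(n)} : p prime, p ∣ n, 1 < p^{v́_p(n)} < n }|
-- (counted as the number of m ∈ {1,…,n} of that form; primes p ∣ n are ≤ n for n ≥ 1)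
eqᵇ : ℕ → ℕ → Bool
eqᵇ a b = ⌊ Data.Nat._≟_ a b ⌋

γ₁ : ℕ → ℕ
γ₁ n = count (λ m → (1 <ᵇ m) ∧ (m <ᵇ n) ∧
                    anyUpTo (λ p → isPrime p ∧ divides p n ∧ eqᵇ m (p ^ vp′ p n)) n) n

-- Let f be the labelling of a maximal Diophantine graph. By maximality two vertices are
-- adjacent as soon as the gcd of their labels divides n. Call m a clique label if m ∣ n or
-- m = p ^ v́_p(n) for a prime p. Two distinct clique labels have gcd dividing n (one of them
-- divides n, or they are powers of distinct primes), so the vertices carrying clique labels
-- form a clique. Conversely every label a has a clique-label divisor h(a), with h(a) = a if
-- a ∣ n and h(a) ∤ n otherwise (a prime power p ^ k dividing a but not n has k ≥ v́_p(n)).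
-- On a clique h is injective, since h(a) = h(b) divides gcd(a, b), which divides n, forcing
-- a = h(a) = b. So the clique number is the number of clique labels in {1, …, n}: the τ(n)
-- divisors, the π(n) − ω(n) primes not dividing n (for which p ^ v́_p(n) = p), and the γ₁(n)
-- powers p ^ v́_p(n) < n with p ∣ n.
module Submission where

open import Defs hiding (sym)
open import Data.Bool using (Bool; true; false; T; if_then_else_; _∧_; _∨_; not)
open import Data.Bool.Properties using (T-≡; T-∧; T-∨)
open import Data.Nat hiding (∣_-_∣)
open import Data.Nat.Properties
open import Data.Nat.Divisibility hiding (divides)
open import Data.Nat.Primality
open import Data.Nat.Primality.Factorisation using (factorise)
open import Data.Nat.Coprimality using (Coprime; coprime-divisor; coprime⇒gcd≡1)
open import Data.Nat.GCD using (gcd; gcd[m,n]∣m; gcd[m,n]∣n; gcd-comm; gcd-greatest)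
open import Data.Nat.ListAction using (product)
open import Data.List using ([]; _∷_)
open import Data.List.Relation.Unary.All using (All; []; _∷_)
open import Data.Fin using (Fin; zero; suc; toℕ; fromℕ<; inject₁; opposite)
import Data.Fin as Fin
open import Data.Fin.Properties
  using (toℕ-injective; toℕ<n; toℕ-fromℕ<; toℕ-fromℕ; toℕ-inject₁; opposite-involutive)
open import Data.Fin.Permutation using (Permutation′; _⟨$⟩ʳ_; _⟨$⟩ˡ_; inverseˡ; inverseʳ; reverse)
import Data.Fin.Permutation as Permutation
open import Data.Fin.Subset renaming (∣_∣ to ‖_‖)
  using (Subset; _∈_; _∉_; _-_; _∪_; ⁅_⁆; _⊆_; _⊂_; inside; outside)
open import Data.Fin.Subset.Properties
  using ( nonempty?; Empty-unique; ∣⊥∣≡0; p⊆q⇒∣p∣≤∣q∣; p⊆p∪q; q⊆p∪q; x∈⁅x⁆; ∣⁅x⁆∣≡1; p─q⊆p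
        ; x∈p∧x≢y⇒x∈p-y; x∈p⇒p-x⊂p; x∈p⇒∣p-x∣<∣p∣ )
open import Data.Fin.Subset.Induction using (⊂-wellFounded; Acc; acc)
open import Data.Vec using ([]; _∷_; tabulate; there)
open import Data.Vec.Properties using (lookup∘tabulate; []=⇒lookup; lookup⇒[]=; tabulate-cong)
open import Data.Product using (∃-syntax; ∃₂; _×_; _,_; proj₁; proj₂)
open import Data.Sum using (inj₁; inj₂)
open import Function using (_∘_; flip)
open import Function.Bundles using (module Equivalence)
open import Relation.Nullary using (¬_; yes; no; contradiction)
open import Relation.Nullary.Decidable using (toWitness; fromWitness; toWitnessFalse)
open import Relation.Binary.PropositionalEquality
  using (_≡_; _≢_; refl; sym; trans; cong; cong₂; subst; module ≡-Reasoning)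

open Equivalence using (to; from)

prime⇒1< : ∀ {p} → Prime p → 1 < p
prime⇒1< {p} p-prime = nonTrivial⇒n>1 p {{prime⇒nonTrivial p-prime}}

prime∣prime⇒≡ : ∀ {p q} → Prime p → Prime q → p ∣ q → p ≡ q
prime∣prime⇒≡ p-prime q-prime p∣q with prime⇒irreducible q-prime p∣q
... | inj₁ refl = contradiction (prime⇒1< p-prime) (<-irrefl refl)
... | inj₂ p≡q  = p≡q

prime∣^⇒∣ : ∀ {p m} → Prime p → ∀ k → p ∣ m ^ k → p ∣ m
prime∣^⇒∣ p-prime zero    p∣1 = contradiction (∣1⇒≡1 p∣1) (>⇒≢ (prime⇒1< p-prime))
prime∣^⇒∣ {m = m} p-prime (suc k) p∣m*m^k with euclidsLemma m (m ^ k) p-prime p∣m*m^k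
... | inj₁ p∣m   = p∣m
... | inj₂ p∣m^k = prime∣^⇒∣ p-prime k p∣m^k

prime∧1<m<p⇒m∤p : ∀ {p m} → Prime p → 1 < m → m < p → ¬ m ∣ p
prime∧1<m<p⇒m∤p p-prime 1<m m<p m∣p =
  Prime.notComposite p-prime (hasNonTrivialDivisor {{n>1⇒nonTrivial 1<m}} m<p m∣p)

∃prime∣ : ∀ {a} → 1 < a → ∃[ p ] Prime p × p ∣ a
∃prime∣ {a} 1<a with factorise a {{>-nonZero (<-trans z<s 1<a)}}
... | record { factors = [] ; isFactorisation = a≡1 } = contradiction a≡1 (>⇒≢ 1<a)
... | record { factors = p ∷ ps ; isFactorisation = a≡p*Πps ; factorsPrime = p-prime ∷ _ } =
  p , p-prime , subst (p ∣_) (sym a≡p*Πps) (m∣m*n (product ps))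

coprime-^ : ∀ {p q} → Prime p → Prime q → p ≢ q → ∀ i j → Coprime (p ^ i) (q ^ j)
coprime-^ {p} p-prime _ _ i _ {0} (0∣p^i , _) =
  contradiction (0∣⇒≡0 0∣p^i) (≢-nonZero⁻¹ (p ^ i) {{m^n≢0 p i {{prime⇒nonZero p-prime}}}})
coprime-^ _ _ _ _ _ {1} _ = refl
coprime-^ p-prime q-prime p≢q i j {d@(2+ _)} (d∣p^i , d∣q^j) with ∃prime∣ {d} sz<ss
... | r , r-prime , r∣d = contradiction (trans (sym (r≡ p-prime i d∣p^i)) (r≡ q-prime j d∣q^j)) p≢q
  where
  r≡ : ∀ {s} → Prime s → ∀ k → d ∣ s ^ k → r ≡ s
  r≡ s-prime k d∣s^k = prime∣prime⇒≡ r-prime s-prime (prime∣^⇒∣ r-prime k (∣-trans r∣d d∣s^k))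

^-monoʳ-∣ : ∀ p {i j} → i ≤ j → p ^ i ∣ p ^ j
^-monoʳ-∣ p z≤n       = 1∣ _
^-monoʳ-∣ p (s≤s i≤j) = *-monoʳ-∣ p (^-monoʳ-∣ p i≤j)

n<m^n : ∀ {m} → 1 < m → ∀ n → n < m ^ n
n<m^n 1<m zero        = z<s
n<m^n {m} 1<m (suc n) = ≤-<-trans (n<m^n 1<m n) (^-monoʳ-< m 1<m (n<1+n n))

greatest : (ℕ → Bool) → ℕ → ℕ
greatest Q zero    = zero
greatest Q (suc k) = if Q (suc k) then suc k else greatest Q k

greatest-sound : ∀ (Q : ℕ → Bool) → T (Q 0) → ∀ k → T (Q (greatest Q k))
greatest-sound Q Q0 zero = Q0
greatest-sound Q Q0 (suc k) with Q (suc k) in Q[1+k]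
... | true  = from T-≡ Q[1+k]
... | false = greatest-sound Q Q0 k

greatest-maximal : ∀ (Q : ℕ → Bool) {j} k → j ≤ k → T (Q j) → j ≤ greatest Q k
greatest-maximal Q zero    j≤0   _  = j≤0
greatest-maximal Q (suc k) j≤1+k Qj with Q (suc k) in Q[1+k] | m≤n⇒m<n∨m≡n j≤1+k
... | true  | _          = j≤1+k
... | false | inj₁ j<1+k = greatest-maximal Q k (m<1+n⇒m≤n j<1+k) Qj
... | false | inj₂ refl  = contradiction (subst T Q[1+k] Qj) (λ ())

-- `vp` searches with a function local to Defs, which cannot be named here: the
-- left-hand side of go≡greatest is left to unification with its use below, and
-- `suc m` is generalised to `n` to make that unification problem a pattern.
mutual
  vp≡greatest : ∀ p n → vp p n ≡ greatest (λ j → divides (p ^ j) n) n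
  vp≡greatest p zero    = refl
  vp≡greatest p (suc m) with suc m
  ... | n = cong (if divides (p ^ suc m) n then n else_) (go≡greatest p n m)

  go≡greatest : ∀ p n k → _ ≡ greatest (λ j → divides (p ^ j) n) k
  go≡greatest p n zero    = refl
  go≡greatest p n (suc k) = cong (if divides (p ^ suc k) n then suc k else_) (go≡greatest p n k)

p^vp∣n : ∀ p n → p ^ vp p n ∣ n
p^vp∣n p n = subst (λ v → p ^ v ∣ n) (sym (vp≡greatest p n))
  (toWitness (greatest-sound (λ j → divides (p ^ j) n) (fromWitness (1∣ n)) n))

vp-maximal : ∀ {p n j} → 1 < p → .{{NonZero n}} → p ^ j ∣ n → j ≤ vp p n
vp-maximal {p} {n} {j} 1<p p^j∣n = subst (j ≤_) (sym (vp≡greatest p n))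
  (greatest-maximal (λ i → divides (p ^ i) n) n j≤n (fromWitness p^j∣n))
  where
  j≤n : j ≤ n
  j≤n = <⇒≤ (<-≤-trans (n<m^n 1<p j) (∣⇒≤ p^j∣n))

vp′≡1+vp : ∀ p n → vp′ p n ≡ suc (vp p n)
vp′≡1+vp p n = +-comm (vp p n) 1

p^vp′∤n : ∀ {p n} → 1 < p → .{{NonZero n}} → ¬ p ^ vp′ p n ∣ n
p^vp′∤n {p} {n} 1<p p^vp′∣n = <⇒≱ (m<m+n (vp p n) z<s) (vp-maximal 1<p p^vp′∣n)

∤⇒vp≡0 : ∀ {p n} → ¬ p ∣ n → vp p n ≡ 0
∤⇒vp≡0 {p} {n} p∤n with vp p n | p^vp∣n p n
... | zero  | _       = refl
... | suc k | p^1+k∣n = contradiction (∣-trans (m∣m*n (p ^ k)) p^1+k∣n) p∤n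

∤⇒p^vp′≡p : ∀ {p n} → ¬ p ∣ n → p ^ vp′ p n ≡ p
∤⇒p^vp′≡p {p} {n} p∤n = trans (cong (λ v → p ^ (v + 1)) (∤⇒vp≡0 p∤n)) (*-identityʳ p)

∣⇒p<p^vp′ : ∀ {p n} → 1 < p → .{{NonZero n}} → p ∣ n → p < p ^ vp′ p n
∣⇒p<p^vp′ {p} {n} 1<p p∣n = subst (_< p ^ vp′ p n) (*-identityʳ p) (^-monoʳ-< p 1<p 1<vp′)
  where
  1<vp′ : 1 < vp′ p n
  1<vp′ = +-monoˡ-< 1 (vp-maximal {j = 1} 1<p (subst (_∣ n) (sym (*-identityʳ p)) p∣n))

product∤⇒∃prime-power : ∀ {ps} → All Prime ps → ∀ {n} → ¬ product ps ∣ n →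
                         ∃₂ λ p k → Prime p × p ^ k ∣ product ps × ¬ p ^ k ∣ n
product∤⇒∃prime-power []                    1∤n = contradiction (1∣ _) 1∤n
product∤⇒∃prime-power {p ∷ ps} (p-prime ∷ ps-prime) {n} Π∤n with p ∣? n
... | no p∤n = p , 1 , p-prime , *-monoʳ-∣ p (1∣ product ps) , p∤n ∘ subst (_∣ n) (*-identityʳ p)
... | yes (divides-refl m)
  with product∤⇒∃prime-power ps-prime (Π∤n ∘ subst (p * product ps ∣_) (*-comm p m) ∘ *-monoʳ-∣ p)
...   | q , k , q-prime , q^k∣Π , q^k∤m with q ≟ p
...     | yes refl = p , suc k , p-prime , *-monoʳ-∣ p q^k∣Π ,
                     q^k∤m ∘ *-cancelˡ-∣ p {{prime⇒nonZero p-prime}} ∘ subst (p * p ^ k ∣_) (*-comm m p)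
...     | no q≢p   = q , k , q-prime , ∣n⇒∣m*n p q^k∣Π ,
                     q^k∤m ∘ coprime-divisor q^k⊥p ∘ subst (q ^ k ∣_) (*-comm m p)
  where
  q^k⊥p : Coprime (q ^ k) p
  q^k⊥p = subst (Coprime (q ^ k)) (*-identityʳ p) (coprime-^ q-prime p-prime q≢p k 1)

∤⇒∃prime-power : ∀ {a n} → .{{NonZero a}} → ¬ a ∣ n →
                 ∃₂ λ p k → Prime p × p ^ k ∣ a × ¬ p ^ k ∣ n
∤⇒∃prime-power {a} a∤n with factorise a
... | record { isFactorisation = a≡Π ; factorsPrime = ps-prime }
  with product∤⇒∃prime-power ps-prime (a∤n ∘ subst (_∣ _) (sym a≡Π))
...   | p , k , p-prime , p^k∣Π , p^k∤n = p , k , p-prime , subst (p ^ k ∣_) (sym a≡Π) p^k∣Π , p^k∤n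

∤⇒∃p^vp′∣ : ∀ {a n} → .{{NonZero a}} → ¬ a ∣ n → ∃[ p ] Prime p × p ^ vp′ p n ∣ a
∤⇒∃p^vp′∣ {a} {n} a∤n with ∤⇒∃prime-power a∤n
... | p , k , p-prime , p^k∣a , p^k∤n = p , p-prime , ∣-trans (^-monoʳ-∣ p vp′≤k) p^k∣a
  where
  vp′≤k : vp′ p n ≤ k
  vp′≤k = subst (_≤ k) (sym (vp′≡1+vp p n))
    (≰⇒> (λ k≤vp → p^k∤n (∣-trans (^-monoʳ-∣ p k≤vp) (p^vp∣n p n))))

data CliqueLabel (n : ℕ) : ℕ → Set where
  divisor     : ∀ {d} → d ∣ n → CliqueLabel n d
  prime-power : ∀ {p} → Prime p → CliqueLabel n (p ^ vp′ p n)

cliqueLabel-gcd∣ : ∀ {n a b} → CliqueLabel n a → CliqueLabel n b → a ≢ b → gcd a b ∣ n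
cliqueLabel-gcd∣ {a = a} {b} (divisor a∣n) _ _ = ∣-trans (gcd[m,n]∣m a b) a∣n
cliqueLabel-gcd∣ {a = a} {b} _ (divisor b∣n) _ = ∣-trans (gcd[m,n]∣n a b) b∣n
cliqueLabel-gcd∣ {n} (prime-power {p} p-prime) (prime-power {q} q-prime) a≢b with p ≟ q
... | yes refl = contradiction refl a≢b
... | no p≢q   = subst (_∣ n) (sym (coprime⇒gcd≡1 p^vp′⊥q^vp′)) (1∣ n)
  where
  p^vp′⊥q^vp′ : Coprime (p ^ vp′ p n) (q ^ vp′ q n)
  p^vp′⊥q^vp′ = coprime-^ p-prime q-prime p≢q (vp′ p n) (vp′ q n)

∃cliqueLabel∣ : ∀ {n} a → .{{NonZero a}} → ∃[ m ] CliqueLabel n m × m ∣ a × (m ∣ n → m ≡ a)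
∃cliqueLabel∣ {n} a with a ∣? n
... | yes a∣n = a , divisor a∣n , ∣-refl , λ _ → refl
... | no a∤n with ∤⇒∃p^vp′∣ a∤n
...   | p , p-prime , p^vp′∣a =
  p ^ vp′ p n , prime-power p-prime , p^vp′∣a , flip contradiction (p^vp′∤n (prime⇒1< p-prime) {{n≢0}})
  where
  n≢0 : NonZero n
  n≢0 = ≢-nonZero (λ n≡0 → a∤n (subst (a ∣_) (sym n≡0) (a ∣0)))

anyUpTo-sound : ∀ P N → T (anyUpTo P N) → ∃[ p ] T (P p)
anyUpTo-sound P zero    ()
anyUpTo-sound P (suc N) any with to T-∨ any
... | inj₁ P[1+N] = suc N , P[1+N]
... | inj₂ any′   = anyUpTo-sound P N any′

anyUpTo-complete : ∀ P {p} N → 1 ≤ p → p ≤ N → T (P p) → T (anyUpTo P N)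
anyUpTo-complete P zero    (s≤s _) ()
anyUpTo-complete P (suc N) 1≤p p≤1+N Pp with m≤n⇒m<n∨m≡n p≤1+N
... | inj₁ p<1+N = from T-∨ (inj₂ (anyUpTo-complete P N 1≤p (m<1+n⇒m≤n p<1+N) Pp))
... | inj₂ refl  = from T-∨ (inj₁ Pp)

primeNonDivisorᵇ : ℕ → ℕ → Bool
primeNonDivisorᵇ n m = isPrime m ∧ not (divides m n)

γ₁-witnessᵇ : ℕ → ℕ → ℕ → Bool
γ₁-witnessᵇ n m p = isPrime p ∧ divides p n ∧ eqᵇ m (p ^ vp′ p n)

-- γ₁ n is by definition count (γ₁-memberᵇ n) n.
γ₁-memberᵇ : ℕ → ℕ → Bool
γ₁-memberᵇ n m = (1 <ᵇ m) ∧ (m <ᵇ n) ∧ anyUpTo (γ₁-witnessᵇ n m) n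

cliqueLabelᵇ : ℕ → ℕ → Bool
cliqueLabelᵇ n m = (divides m n ∨ primeNonDivisorᵇ n m) ∨ γ₁-memberᵇ n m

γ₁-memberᵇ-sound : ∀ {n m} → T (γ₁-memberᵇ n m) →
                   m < n × ∃[ p ] Prime p × p ∣ n × m ≡ p ^ vp′ p n
γ₁-memberᵇ-sound {n} {m} γ =
  let _       , γ′      = to (T-∧ {1 <ᵇ m}) γ
      m<ᵇn    , any     = to (T-∧ {m <ᵇ n}) γ′
      p       , w       = anyUpTo-sound (γ₁-witnessᵇ n m) n any
      p-prime , w′      = to (T-∧ {isPrime p}) w
      p∣n     , m≡p^vp′ = to (T-∧ {divides p n}) w′
  in <ᵇ⇒< m n m<ᵇn , p , toWitness p-prime , toWitness p∣n , toWitness m≡p^vp′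

γ₁-memberᵇ-complete : ∀ {n p} → .{{NonZero n}} → Prime p → p ∣ n → p ^ vp′ p n ≤ n →
                      T (γ₁-memberᵇ n (p ^ vp′ p n))
γ₁-memberᵇ-complete {n} {p} p-prime p∣n M≤n =
  from (T-∧ {1 <ᵇ M}) (<⇒<ᵇ 1<M , from (T-∧ {M <ᵇ n})
    (<⇒<ᵇ M<n , anyUpTo-complete (γ₁-witnessᵇ n M) n (<⇒≤ 1<p) (∣⇒≤ p∣n) witness))
  where
  M : ℕ
  M = p ^ vp′ p n
  1<p : 1 < p
  1<p = prime⇒1< p-prime
  1<M : 1 < M
  1<M = <-trans 1<p (∣⇒p<p^vp′ 1<p p∣n)
  M<n : M < n
  M<n = ≤∧≢⇒< M≤n (λ M≡n → p^vp′∤n 1<p (subst (M ∣_) M≡n ∣-refl))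
  witness : T (γ₁-witnessᵇ n M p)
  witness = from (T-∧ {isPrime p})
    (fromWitness p-prime , from (T-∧ {divides p n}) (fromWitness p∣n , fromWitness refl))

γ₁-memberᵇ⇒∤×¬prime : ∀ {n m} → .{{NonZero n}} → T (γ₁-memberᵇ n m) → ¬ m ∣ n × ¬ Prime m
γ₁-memberᵇ⇒∤×¬prime {n} {m} γ with γ₁-memberᵇ-sound {n} {m} γ
... | _ , p , p-prime , p∣n , refl = p^vp′∤n 1<p , λ M-prime →
  <⇒≢ (∣⇒p<p^vp′ 1<p p∣n) (prime∣prime⇒≡ p-prime M-prime p∣M)
  where
  1<p : 1 < p
  1<p = prime⇒1< p-prime
  p∣M : p ∣ p ^ vp′ p n
  p∣M = subst (p ∣_) (sym (cong (p ^_) (vp′≡1+vp p n))) (m∣m*n _)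

cliqueLabelᵇ-sound : ∀ {n m} → T (cliqueLabelᵇ n m) → CliqueLabel n m
cliqueLabelᵇ-sound {n} {m} ℓ with m ∣? n | prime? m
... | yes m∣n | _           = divisor m∣n
... | no m∤n  | yes m-prime = subst (CliqueLabel n) (∤⇒p^vp′≡p m∤n) (prime-power m-prime)
... | no _    | no _ with γ₁-memberᵇ-sound {n} {m} ℓ
...   | _ , _ , p-prime , _ , m≡p^vp′ = subst (CliqueLabel n) (sym m≡p^vp′) (prime-power p-prime)

cliqueLabelᵇ-complete : ∀ {n m} → .{{NonZero n}} → m ≤ n → CliqueLabel n m → T (cliqueLabelᵇ n m)
cliqueLabelᵇ-complete {n} _ (divisor {m} m∣n) with m ∣? n
... | yes _  = _
... | no m∤n = contradiction m∣n m∤n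
cliqueLabelᵇ-complete {n} M≤n (prime-power {p} p-prime)
  with p ∣? n | p ^ vp′ p n ∣? n | prime? (p ^ vp′ p n)
... | _       | yes _ | _     = _
... | _       | no _  | yes _ = _
... | yes p∣n | no _  | no _  = γ₁-memberᵇ-complete p-prime p∣n M≤n
... | no p∤n  | no _  | no ¬M-prime =
  contradiction (subst Prime (sym (∤⇒p^vp′≡p p∤n)) p-prime) ¬M-prime

count-suc : ∀ (P : ℕ → Bool) N → T (P (suc N)) → count P (suc N) ≡ suc (count P N)
count-suc P N P[1+N] rewrite to T-≡ P[1+N] = refl

count-none : ∀ (P : ℕ → Bool) N → (∀ m → m ≤ N → ¬ T (P m)) → count P N ≡ 0
count-none P zero    _    = refl
count-none P (suc N) none with P (suc N) in P[1+N]
... | true  = contradiction (from T-≡ P[1+N]) (none (suc N) ≤-refl)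
... | false = count-none P N (λ m m≤N → none m (m≤n⇒m≤1+n m≤N))

count-only-1 : ∀ (P : ℕ → Bool) N → T (P 1) → (∀ m → 1 < m → m ≤ suc N → ¬ T (P m)) →
               count P (suc N) ≡ 1
count-only-1 P zero    P1 _    = count-suc P 0 P1
count-only-1 P (suc N) P1 none with P (2+ N) in P[2+N]
... | true  = contradiction (from T-≡ P[2+N]) (none (2+ N) (s<s z<s) ≤-refl)
... | false = count-only-1 P N P1 (λ m 1<m m≤1+N → none m 1<m (m≤n⇒m≤1+n m≤1+N))

count-∨ : ∀ (P Q : ℕ → Bool) N → (∀ m → T (P m) → ¬ T (Q m)) →
          count (λ m → P m ∨ Q m) N ≡ count P N + count Q N
count-∨ P Q zero    _        = refl
count-∨ P Q (suc N) disjoint with P (suc N) in P[1+N] | Q (suc N) in Q[1+N]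
... | true  | true  = contradiction (from T-≡ Q[1+N]) (disjoint (suc N) (from T-≡ P[1+N]))
... | true  | false = cong suc (count-∨ P Q N disjoint)
... | false | true  = trans (cong suc (count-∨ P Q N disjoint)) (sym (+-suc _ _))
... | false | false = count-∨ P Q N disjoint

count-split : ∀ (P Q : ℕ → Bool) N →
              count P N ≡ count (λ m → P m ∧ Q m) N + count (λ m → P m ∧ not (Q m)) N
count-split P Q zero = refl
count-split P Q (suc N) with P (suc N) | Q (suc N)
... | true  | true  = cong suc (count-split P Q N)
... | true  | false = trans (cong suc (count-split P Q N)) (sym (+-suc _ _))
... | false | _     = count-split P Q N

divisor-primeNonDivisor-disjoint : ∀ n m → T (divides m n) → ¬ T (primeNonDivisorᵇ n m)
divisor-primeNonDivisor-disjoint n m m∣n pnd =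
  toWitnessFalse (proj₂ (to (T-∧ {isPrime m}) pnd)) (toWitness m∣n)

divisorOrPrime-γ₁-disjoint : ∀ n → .{{NonZero n}} → ∀ m →
                              T (divides m n ∨ primeNonDivisorᵇ n m) → ¬ T (γ₁-memberᵇ n m)
divisorOrPrime-γ₁-disjoint n m t γ with γ₁-memberᵇ⇒∤×¬prime {n} {m} γ | to (T-∨ {divides m n}) t
... | m∤n , _      | inj₁ m∣n = m∤n (toWitness m∣n)
... | _ , ¬m-prime | inj₂ pnd = ¬m-prime (toWitness (proj₁ (to (T-∧ {isPrime m}) pnd)))

τ+π∸ω≡τ+#primeNonDivisors : ∀ n → τ n + π n ∸ ω n ≡ τ n + count (primeNonDivisorᵇ n) n
τ+π∸ω≡τ+#primeNonDivisors n = begin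
  τ n + π n ∸ ω n        ≡⟨ cong (λ k → τ n + k ∸ ω n) (count-split isPrime (λ m → divides m n) n) ⟩
  τ n + (ω n + X) ∸ ω n  ≡⟨ +-∸-assoc (τ n) (m≤m+n (ω n) X) ⟩
  τ n + (ω n + X ∸ ω n)  ≡⟨ cong (τ n +_) (m+n∸m≡n (ω n) X) ⟩
  τ n + X                ∎
  where
  open ≡-Reasoning
  X : ℕ
  X = count (primeNonDivisorᵇ n) n

count-cliqueLabelᵇ : ∀ n → .{{NonZero n}} → count (cliqueLabelᵇ n) n ≡ τ n + π n ∸ ω n + γ₁ n
count-cliqueLabelᵇ n = begin
  count (cliqueLabelᵇ n) n
    ≡⟨ count-∨ divisorOrPrime (γ₁-memberᵇ n) n (divisorOrPrime-γ₁-disjoint n) ⟩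
  count divisorOrPrime n + γ₁ n
    ≡⟨ cong (_+ γ₁ n) (count-∨ (λ m → divides m n) (primeNonDivisorᵇ n) n
                                (divisor-primeNonDivisor-disjoint n)) ⟩
  τ n + count (primeNonDivisorᵇ n) n + γ₁ n
    ≡⟨ cong (_+ γ₁ n) (τ+π∸ω≡τ+#primeNonDivisors n) ⟨
  τ n + π n ∸ ω n + γ₁ n ∎
  where
  open ≡-Reasoning
  divisorOrPrime : ℕ → Bool
  divisorOrPrime m = divides m n ∨ primeNonDivisorᵇ n m

τ-prime : ∀ {p} → Prime p → τ p ≡ 2
τ-prime {p@(2+ k)} p-prime = begin
  τ p                                      ≡⟨ count-suc (λ d → divides d p) (suc k) (fromWitness ∣-refl) ⟩
  suc (count (λ d → divides d p) (suc k))  ≡⟨ cong suc (count-only-1 _ k (fromWitness (1∣ p)) proper∤p) ⟩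
  2                                        ∎
  where
  open ≡-Reasoning
  proper∤p : ∀ m → 1 < m → m ≤ suc k → ¬ T (divides m p)
  proper∤p m 1<m m≤1+k = prime∧1<m<p⇒m∤p p-prime 1<m (s≤s m≤1+k) ∘ toWitness

ω-prime : ∀ {p} → Prime p → ω p ≡ 1
ω-prime {p@(suc k)} p-prime = begin
  ω p                                            ≡⟨ count-suc (λ q → isPrime q ∧ divides q p) k p∈ω ⟩
  suc (count (λ q → isPrime q ∧ divides q p) k)  ≡⟨ cong suc (count-none _ k below∉ω) ⟩
  1                                              ∎
  where
  open ≡-Reasoning
  p∈ω : T (isPrime p ∧ divides p p)
  p∈ω = from (T-∧ {isPrime p}) (fromWitness p-prime , fromWitness ∣-refl)
  below∉ω : ∀ q → q ≤ k → ¬ T (isPrime q ∧ divides q p)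
  below∉ω q q≤k w = let q-prime , q∣p = to (T-∧ {isPrime q}) w in
    prime∧1<m<p⇒m∤p p-prime (prime⇒1< (toWitness q-prime)) (s≤s q≤k) (toWitness q∣p)

γ₁-prime : ∀ {p} → Prime p → γ₁ p ≡ 0
γ₁-prime {p} p-prime = count-none (γ₁-memberᵇ p) p (λ m _ → γ₁-member-absent m)
  where
  instance
    _ : NonZero p
    _ = prime⇒nonZero p-prime
  γ₁-member-absent : ∀ m → ¬ T (γ₁-memberᵇ p m)
  γ₁-member-absent m γ with γ₁-memberᵇ-sound {p} {m} γ
  ... | m<p , q , q-prime , q∣p , m≡q^vp′ with prime∣prime⇒≡ q-prime p-prime q∣p
  ...   | refl = <-asym m<p (subst (q <_) (sym m≡q^vp′) (∣⇒p<p^vp′ (prime⇒1< q-prime) q∣p))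

prime⇒τ+π∸ω+γ₁≡π+1 : ∀ {p} → Prime p → τ p + π p ∸ ω p + γ₁ p ≡ π p + 1
prime⇒τ+π∸ω+γ₁≡π+1 {p} p-prime rewrite τ-prime p-prime | ω-prime p-prime | γ₁-prime p-prime =
  trans (+-identityʳ _) (+-comm 1 (π p))

∈-tabulate⁻ : ∀ {n} {F : Fin n → Bool} {i} → i ∈ tabulate F → T (F i)
∈-tabulate⁻ {F = F} {i} i∈F = from T-≡ (trans (sym (lookup∘tabulate F i)) ([]=⇒lookup i∈F))

∈-tabulate⁺ : ∀ {n} {F : Fin n → Bool} {i} → T (F i) → i ∈ tabulate F
∈-tabulate⁺ {F = F} {i} Fi = lookup⇒[]= i (tabulate F) (trans (lookup∘tabulate F i) (to T-≡ Fi))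

x∉p-x : ∀ {n} (p : Subset n) x → x ∉ p - x
x∉p-x (_ ∷ p) zero    ()
x∉p-x (_ ∷ p) (suc x) (there x∈p-x) = x∉p-x p x x∈p-x

∣p∪q∣≤∣p∣+∣q∣ : ∀ {n} (p q : Subset n) → ‖ p ∪ q ‖ ≤ ‖ p ‖ + ‖ q ‖
∣p∪q∣≤∣p∣+∣q∣ []            []            = z≤n
∣p∪q∣≤∣p∣+∣q∣ (inside  ∷ p) (inside  ∷ q) =
  s≤s (≤-trans (∣p∪q∣≤∣p∣+∣q∣ p q) (+-monoʳ-≤ ‖ p ‖ (n≤1+n ‖ q ‖)))
∣p∪q∣≤∣p∣+∣q∣ (inside  ∷ p) (outside ∷ q) = s≤s (∣p∪q∣≤∣p∣+∣q∣ p q)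
∣p∪q∣≤∣p∣+∣q∣ (outside ∷ p) (inside  ∷ q) =
  subst (suc ‖ p ∪ q ‖ ≤_) (sym (+-suc ‖ p ‖ ‖ q ‖)) (s≤s (∣p∪q∣≤∣p∣+∣q∣ p q))
∣p∪q∣≤∣p∣+∣q∣ (outside ∷ p) (outside ∷ q) = ∣p∪q∣≤∣p∣+∣q∣ p q

∣p∣≤1+∣p-x∣ : ∀ {n} (p : Subset n) x → ‖ p ‖ ≤ suc ‖ p - x ‖
∣p∣≤1+∣p-x∣ p x = begin
  ‖ p ‖                   ≤⟨ p⊆q⇒∣p∣≤∣q∣ p⊆[p-x]∪⁅x⁆ ⟩
  ‖ (p - x) ∪ ⁅ x ⁆ ‖     ≤⟨ ∣p∪q∣≤∣p∣+∣q∣ (p - x) ⁅ x ⁆ ⟩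
  ‖ p - x ‖ + ‖ ⁅ x ⁆ ‖   ≡⟨ cong (‖ p - x ‖ +_) (∣⁅x⁆∣≡1 x) ⟩
  ‖ p - x ‖ + 1           ≡⟨ +-comm ‖ p - x ‖ 1 ⟩
  suc ‖ p - x ‖           ∎
  where
  open ≤-Reasoning
  p⊆[p-x]∪⁅x⁆ : p ⊆ (p - x) ∪ ⁅ x ⁆
  p⊆[p-x]∪⁅x⁆ {y} y∈p with y Fin.≟ x
  ... | yes refl = q⊆p∪q (p - x) ⁅ x ⁆ (x∈⁅x⁆ x)
  ... | no y≢x   = p⊆p∪q ⁅ x ⁆ (x∈p∧x≢y⇒x∈p-y y∈p y≢x)

module _ {n} (g : Fin n → Fin n) where

  injectiveOn⇒∣p∣≤∣q∣ : ∀ {p q : Subset n} → (∀ {x} → x ∈ p → g x ∈ q) →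
                        (∀ {x y} → x ∈ p → y ∈ p → g x ≡ g y → x ≡ y) → ‖ p ‖ ≤ ‖ q ‖
  injectiveOn⇒∣p∣≤∣q∣ {p} = go (⊂-wellFounded p)
    where
    go : ∀ {p q : Subset n} → Acc _⊂_ p → (∀ {x} → x ∈ p → g x ∈ q) →
         (∀ {x y} → x ∈ p → y ∈ p → g x ≡ g y → x ≡ y) → ‖ p ‖ ≤ ‖ q ‖
    go {p} {q} (acc smaller) maps injective with nonempty? p
    ... | no p-empty =
      subst (_≤ ‖ q ‖) (sym (trans (cong ‖_‖ (Empty-unique p-empty)) (∣⊥∣≡0 n))) z≤n
    ... | yes (x , x∈p) = begin
      ‖ p ‖            ≤⟨ ∣p∣≤1+∣p-x∣ p x ⟩
      suc ‖ p - x ‖    ≤⟨ s≤s (go (smaller (x∈p⇒p-x⊂p x∈p)) maps′ injective′) ⟩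
      suc ‖ q - g x ‖  ≤⟨ x∈p⇒∣p-x∣<∣p∣ (maps x∈p) ⟩
      ‖ q ‖            ∎
      where
      open ≤-Reasoning
      ∈p : ∀ {y} → y ∈ p - x → y ∈ p
      ∈p = p─q⊆p p ⁅ x ⁆
      maps′ : ∀ {y} → y ∈ p - x → g y ∈ q - g x
      maps′ {y} y∈p-x = x∈p∧x≢y⇒x∈p-y (maps (∈p y∈p-x))
        (λ gy≡gx → x∉p-x p x (subst (_∈ p - x) (injective (∈p y∈p-x) x∈p gy≡gx) y∈p-x))
      injective′ : ∀ {y z} → y ∈ p - x → z ∈ p - x → g y ≡ g z → y ≡ z
      injective′ y∈ z∈ = injective (∈p y∈) (∈p z∈)

permutation-injective : ∀ {n} (σ : Permutation′ n) {x y} → σ ⟨$⟩ʳ x ≡ σ ⟨$⟩ʳ y → x ≡ y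
permutation-injective σ {x} {y} σx≡σy = begin
  x                    ≡⟨ inverseˡ σ ⟨
  σ ⟨$⟩ˡ (σ ⟨$⟩ʳ x)    ≡⟨ cong (σ ⟨$⟩ˡ_) σx≡σy ⟩
  σ ⟨$⟩ˡ (σ ⟨$⟩ʳ y)    ≡⟨ inverseˡ σ ⟩
  y                    ∎
  where open ≡-Reasoning

∣tabulate∘σ∣≤∣tabulate∣ : ∀ {n} (σ : Permutation′ n) (F : Fin n → Bool) →
                          ‖ tabulate (F ∘ (σ ⟨$⟩ʳ_)) ‖ ≤ ‖ tabulate F ‖
∣tabulate∘σ∣≤∣tabulate∣ σ F =
  injectiveOn⇒∣p∣≤∣q∣ (σ ⟨$⟩ʳ_) (∈-tabulate⁺ ∘ ∈-tabulate⁻) (λ _ _ → permutation-injective σ)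

∣tabulate∘σ∣≡∣tabulate∣ : ∀ {n} (σ : Permutation′ n) (F : Fin n → Bool) →
                          ‖ tabulate (F ∘ (σ ⟨$⟩ʳ_)) ‖ ≡ ‖ tabulate F ‖
∣tabulate∘σ∣≡∣tabulate∣ σ F = ≤-antisym (∣tabulate∘σ∣≤∣tabulate∣ σ F) (begin
  ‖ tabulate F ‖
    ≡⟨ cong ‖_‖ (tabulate-cong (λ i → cong F (inverseʳ σ {i}))) ⟨
  ‖ tabulate (F ∘ (σ ⟨$⟩ʳ_) ∘ (σ ⟨$⟩ˡ_)) ‖
    ≤⟨ ∣tabulate∘σ∣≤∣tabulate∣ (Permutation.flip σ) (F ∘ (σ ⟨$⟩ʳ_)) ⟩
  ‖ tabulate (F ∘ (σ ⟨$⟩ʳ_)) ‖ ∎)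
  where open ≤-Reasoning

[_]ᵇ : Bool → ℕ
[ b ]ᵇ = if b then 1 else 0

∣∷∣ : ∀ {n} b (p : Subset n) → ‖ b ∷ p ‖ ≡ [ b ]ᵇ + ‖ p ‖
∣∷∣ true  _ = refl
∣∷∣ false _ = refl

-- `count` runs from N down to 1 while `tabulate` runs up from position 0, hence `opposite`.
count≡∣tabulate∘opposite∣ : ∀ (P : ℕ → Bool) N →
                            count P N ≡ ‖ tabulate {n = N} (λ i → P (suc (toℕ (opposite i)))) ‖
count≡∣tabulate∘opposite∣ P zero    = refl
count≡∣tabulate∘opposite∣ P (suc N) = begin
  count P (suc N)                              ≡⟨ cong ([ P (suc N) ]ᵇ +_) (count≡∣tabulate∘opposite∣ P N) ⟩
  [ P (suc N) ]ᵇ + ‖ tabulate (F {N}) ‖        ≡⟨ cong₂ (λ b (p : Subset N) → [ b ]ᵇ + ‖ p ‖) F-zero F∘suc ⟨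
  [ F zero ]ᵇ + ‖ tabulate (F {suc N} ∘ suc) ‖ ≡⟨ ∣∷∣ (F zero) (tabulate (F {suc N} ∘ suc)) ⟨
  ‖ tabulate (F {suc N}) ‖                     ∎
  where
  open ≡-Reasoning
  F : ∀ {M} → Fin M → Bool
  F i = P (suc (toℕ (opposite i)))
  F-zero : F {suc N} zero ≡ P (suc N)
  F-zero = cong (P ∘ suc) (toℕ-fromℕ N)
  F∘suc : tabulate (F {suc N} ∘ suc) ≡ tabulate F
  F∘suc = tabulate-cong (λ i → cong (P ∘ suc) (toℕ-inject₁ (opposite i)))

∣tabulate∣≡count : ∀ (P : ℕ → Bool) N → ‖ tabulate {n = N} (λ i → P (suc (toℕ i))) ‖ ≡ count P N
∣tabulate∣≡count P N = begin
  ‖ tabulate {n = N} (λ i → P (suc (toℕ i))) ‖  ≡⟨ cong ‖_‖ (tabulate-cong F∘opposite) ⟨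
  ‖ tabulate (F ∘ opposite) ‖                   ≡⟨ ∣tabulate∘σ∣≡∣tabulate∣ reverse F ⟩
  ‖ tabulate F ‖                                ≡⟨ count≡∣tabulate∘opposite∣ P N ⟨
  count P N                                     ∎
  where
  open ≡-Reasoning
  F : Fin N → Bool
  F i = P (suc (toℕ (opposite i)))
  F∘opposite : ∀ i → F (opposite i) ≡ P (suc (toℕ i))
  F∘opposite i = cong (P ∘ suc ∘ toℕ) (opposite-involutive i)

suc-toℕ-surjective : ∀ {n m} → 0 < m → m ≤ n → ∃[ i ] suc (toℕ {n} i) ≡ m
suc-toℕ-surjective {m = suc m} _ m<n = fromℕ< m<n , cong suc (toℕ-fromℕ< m<n)

module MaximalDiophantineGraph {n} .{{_ : NonZero n}} (G : Graph n)
                               (G-maximal : MaximalDiophantine G) where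

  f : Permutation′ n
  f = proj₁ (proj₁ G-maximal)

  f-diophantine : ∀ u v → adj G u v ≡ true → gcd (label f u) (label f v) ∣ n
  f-diophantine = proj₂ (proj₁ G-maximal)

  gcd∣⇒adjacent : ∀ {u v} → u ≢ v → gcd (label f u) (label f v) ∣ n → adj G u v ≡ true
  gcd∣⇒adjacent {u} {v} u≢v gcd∣n with adj G u v in uv
  ... | true  = refl
  ... | false = contradiction (f , diophantine-with-uv) (proj₂ G-maximal u v u≢v uv)
    where
    diophantine-with-uv : ∀ x y → addEdgeRel G u v x y → gcd (label f x) (label f y) ∣ n
    diophantine-with-uv x y (inj₁ xy)                   = f-diophantine x y xy
    diophantine-with-uv _ _ (inj₂ (inj₁ (refl , refl))) = gcd∣n
    diophantine-with-uv _ _ (inj₂ (inj₂ (refl , refl))) =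
      subst (_∣ n) (gcd-comm (label f u) (label f v)) gcd∣n

  label-injective : ∀ {u v} → label f u ≡ label f v → u ≡ v
  label-injective = permutation-injective f ∘ toℕ-injective ∘ suc-injective

  label≤n : ∀ u → label f u ≤ n
  label≤n u = toℕ<n (f ⟨$⟩ʳ u)

  cliqueLabelled : Subset n
  cliqueLabelled = tabulate (λ u → cliqueLabelᵇ n (label f u))

  cliqueLabelled-isClique : IsClique G cliqueLabelled
  cliqueLabelled-isClique u v u∈ v∈ u≢v = gcd∣⇒adjacent u≢v
    (cliqueLabel-gcd∣ (cliqueLabelᵇ-sound (∈-tabulate⁻ u∈)) (cliqueLabelᵇ-sound (∈-tabulate⁻ v∈))
                      (u≢v ∘ label-injective))

  ∣cliqueLabelled∣ : ‖ cliqueLabelled ‖ ≡ count (cliqueLabelᵇ n) n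
  ∣cliqueLabelled∣ = trans (∣tabulate∘σ∣≡∣tabulate∣ f _) (∣tabulate∣≡count (cliqueLabelᵇ n) n)

  -- Position i stands for the number suc (toℕ i), as in `label`.
  cliqueLabelPositions : Subset n
  cliqueLabelPositions = tabulate (λ i → cliqueLabelᵇ n (suc (toℕ i)))

  ∃position : ∀ u → ∃[ i ] i ∈ cliqueLabelPositions × suc (toℕ i) ∣ label f u ×
                            (suc (toℕ i) ∣ n → suc (toℕ i) ≡ label f u)
  ∃position u with ∃cliqueLabel∣ {n} (label f u)
  ... | zero  , _ , 0∣label , _ = contradiction (0∣⇒≡0 0∣label) λ ()
  ... | suc m , ℓ , m∣label , m∣n⇒m≡label
    with m≤n ← ≤-trans (∣⇒≤ m∣label) (label≤n u)
    with i , refl ← suc-toℕ-surjective z<s m≤n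
       = i , ∈-tabulate⁺ (cliqueLabelᵇ-complete m≤n ℓ) , m∣label , m∣n⇒m≡label

  position : Fin n → Fin n
  position u = proj₁ (∃position u)

  position∈ : ∀ u → position u ∈ cliqueLabelPositions
  position∈ u = proj₁ (proj₂ (∃position u))

  clique-bound : ∀ S → IsClique G S → ‖ S ‖ ≤ count (cliqueLabelᵇ n) n
  clique-bound S S-clique = begin
    ‖ S ‖                     ≤⟨ injectiveOn⇒∣p∣≤∣q∣ position (λ {u} _ → position∈ u) position-injective ⟩
    ‖ cliqueLabelPositions ‖  ≡⟨ ∣tabulate∣≡count (cliqueLabelᵇ n) n ⟩
    count (cliqueLabelᵇ n) n  ∎
    where
    open ≤-Reasoning
    position-injective : ∀ {u v} → u ∈ S → v ∈ S → position u ≡ position v → u ≡ v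
    position-injective {u} {v} u∈S v∈S pu≡pv with u Fin.≟ v
    ... | yes u≡v = u≡v
    ... | no u≢v with ∃position u | ∃position v | pu≡pv
    ...   | i , _ , i∣label-u , i∣n⇒i≡label-u | .i , _ , i∣label-v , i∣n⇒i≡label-v | refl =
      label-injective (trans (sym (i∣n⇒i≡label-u i∣n)) (i∣n⇒i≡label-v i∣n))
      where
      i∣n : suc (toℕ i) ∣ n
      i∣n = ∣-trans (gcd-greatest i∣label-u i∣label-v) (f-diophantine u v (S-clique u v u∈S v∈S u≢v))

  cliqueNumber : IsCliqueNumber G (count (cliqueLabelᵇ n) n)
  cliqueNumber = (cliqueLabelled , cliqueLabelled-isClique , ∣cliqueLabelled∣) , clique-bound

theorem3p4 : (n : ℕ) → 1 ≤ n → (G : Graph n) → MaximalDiophantine G →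
    IsCliqueNumber G (τ n + π n ∸ ω n + γ₁ n) × (Prime n → IsCliqueNumber G (π n + 1))
theorem3p4 n 1≤n G G-maximal = clique-number , λ n-prime →
  subst (IsCliqueNumber G) (prime⇒τ+π∸ω+γ₁≡π+1 n-prime) clique-number
  where
  instance
    _ : NonZero n
    _ = >-nonZero 1≤n
  clique-number : IsCliqueNumber G (τ n + π n ∸ ω n + γ₁ n)
  clique-number =
    subst (IsCliqueNumber G) (count-cliqueLabelᵇ n) (MaximalDiophantineGraph.cliqueNumber G G-maximal)
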